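{- Let $M$ be a matroid with $\rho(M)>1$, and let $A$ and $B$ be two disjoint bases of $M$. Then there exist at least two disjoint symmetric exchanges relative to $A$ and $B$; that is, there exist $a_1,a_2\in A$ and $b_1,b_2\in B$ with $a_1\neq a_2$ and $b_1\neq b_2$ such that for each $i=1,2$ both $A-a_i+b_i$ and $B-b_i+a_i$ are bases of $M$.
   Context: $\rho(M)$ denotes the rank of $M$. Notation: $A+x=A\cup\{x\}$, $A-x=A\setminus\{x\}$. For disjoint bases $A,B$, a pair $(a,b)$ with $a\in A$, $b\in B$ is a symmetric exchange relative to $A$ and $B$ if both $A-a+b$ and $B-b+a$ are bases. Two symmetric exchanges $(a_1,b_1)$, $(a_2,b_2)$ are disjoint if $a_1\neq a_2$ and $b_1\neq b_2$. -}

module Defs where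

open import Data.Nat using (ℕ; _<_; _>_)
open import Data.Fin using (Fin)
open import Data.Fin.Subset using (Subset; _⊆_; _⊂_; _∈_; _∉_; ∣_∣; ⊥; _∪_; _-_; _∩_; Empty)
open import Data.Fin.Subset renaming (⁅_⁆ to ⁅_⁆)
open import Data.Product using (Σ; ∃; _×_; _,_)
open import Relation.Nullary using (¬_)
open import Level using (Level; suc; _⊔_) renaming (zero to lzero)

record Matroid (n : ℕ) : Set₁ where
  field
    Indep          : Subset n → Set
    indep-empty    : Indep ⊥
    indep-subset   : ∀ {X Y} → Y ⊆ X → Indep X → Indep Y
    indep-exchange : ∀ {X Y} → Indep X → Indep Y → ∣ X ∣ < ∣ Y ∣ →
                     ∃ λ y → y ∈ Y × y ∉ X × Indep (X ∪ ⁅ y ⁆)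

module _ {n : ℕ} (M : Matroid n) where
  open Matroid M

  IsBase : Subset n → Set
  IsBase B = Indep B × (∀ X → B ⊂ X → ¬ Indep X)

  RankGreaterThan : ℕ → Set
  RankGreaterThan k = ∃ λ I → Indep I × ∣ I ∣ > k

_+ₑ_ : ∀ {n} → Subset n → Fin n → Subset n
A +ₑ x = A ∪ ⁅ x ⁆

_-ₑ_ : ∀ {n} → Subset n → Fin n → Subset n
A -ₑ x = A - x

infixl 6 _+ₑ_ _-ₑ_

Disjoint : ∀ {n} → Subset n → Subset n → Set
Disjoint A B = Empty (A ∩ B)

module _ {n : ℕ} (M : Matroid n) where
  SymmetricExchange : Subset n → Subset n → Fin n → Fin n → Set
  SymmetricExchange A B a b =
    a ∈ A × b ∈ B × IsBase M (A -ₑ a +ₑ b) × IsBase M (B -ₑ b +ₑ a)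

-- Brualdi's symmetric exchange property gives, for every a ∈ A, some b ∈ B
-- with (a , b) a symmetric exchange.  Take a₁ ≠ a₂ in A with partners b₁, b₂;
-- if b₁ = b₂, take b′ ≠ b₁ in B with partner a′ (exchanging the roles of A and B).
-- Among the three exchanges (a₁ , b₁), (a₂ , b₂), (a′ , b′) two are disjoint.
--
-- Brualdi's property is proved without circuits: for T ⊆ B, either T + a is
-- independent or a symmetric exchange with a exists, by induction on ∣ T ∣;
-- for T = B the first alternative fails because B is a base and a ∉ B.
module Submission where

open import Defs

open import Data.Nat using (ℕ; zero; suc; _+_; _≤_; _<_; z≤n; s≤s)
open import Data.Nat.Properties
  using (≤-refl; ≤-trans; ≤-reflexive; <-≤-trans; ≤-<-trans; <-irrefl; >⇒≢; ≤-pred; ≰⇒>; n≮0; m≤m+n; +-suc; _≤?_)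
open import Data.Fin using (Fin; zero; suc; _≟_)
open import Data.Fin.Subset
  using (Subset; inside; outside; _∪_; _-_; ⁅_⁆; _∈_; _∉_; _⊆_; ∣_∣; Nonempty)
open import Data.Fin.Subset.Properties
open import Data.Vec using (_∷_)
open import Data.Vec.Base using (_[_]=_)
open _[_]=_
open import Data.Product using (∃; _×_; _,_; proj₁)
open import Data.Sum using (_⊎_; inj₁; inj₂)
open import Function using (_∘_)
open import Relation.Nullary using (¬_; yes; no; contradiction)
open import Relation.Binary.Definitions using (DecidableEquality)
open import Relation.Binary.PropositionalEquality using (_≡_; _≢_; refl; sym; trans; cong)

private
  variable
    n : ℕ
    p q r : Subset n
    x y z : Fin n

x∈p∪⁅y⁆⇒x∈p⊎x≡y : x ∈ p ∪ ⁅ y ⁆ → x ∈ p ⊎ x ≡ y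
x∈p∪⁅y⁆⇒x∈p⊎x≡y {p = p} {y = y} x∈ with x∈p∪q⁻ p ⁅ y ⁆ x∈
... | inj₁ x∈p   = inj₁ x∈p
... | inj₂ x∈⁅y⁆ = inj₂ (x∈⁅y⁆⇒x≡y y x∈⁅y⁆)

x∈p∪⁅x⁆ : ∀ x → x ∈ p ∪ ⁅ x ⁆
x∈p∪⁅x⁆ x = x∈p∪q⁺ (inj₂ (x∈⁅x⁆ x))

x∈p⇒x∈p∪⁅y⁆ : x ∈ p → x ∈ p ∪ ⁅ y ⁆
x∈p⇒x∈p∪⁅y⁆ x∈p = x∈p∪q⁺ (inj₁ x∈p)

p⊆r∧x∈r⇒p∪⁅x⁆⊆r : p ⊆ r → x ∈ r → p ∪ ⁅ x ⁆ ⊆ r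
p⊆r∧x∈r⇒p∪⁅x⁆⊆r {p = p} p⊆r x∈r y∈ with x∈p∪⁅y⁆⇒x∈p⊎x≡y {p = p} y∈
... | inj₁ y∈p = p⊆r y∈p
... | inj₂ refl = x∈r

x∈q⇒p∪⁅x⁆∪q⊆p∪q : x ∈ q → (p ∪ ⁅ x ⁆) ∪ q ⊆ p ∪ q
x∈q⇒p∪⁅x⁆∪q⊆p∪q {x = x} {q = q} {p = p} x∈q y∈ with x∈p∪q⁻ (p ∪ ⁅ x ⁆) q y∈
... | inj₂ y∈q = x∈p∪q⁺ (inj₂ y∈q)
... | inj₁ y∈p∪⁅x⁆ with x∈p∪⁅y⁆⇒x∈p⊎x≡y {p = p} y∈p∪⁅x⁆
...   | inj₁ y∈p = x∈p∪q⁺ (inj₁ y∈p)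
...   | inj₂ refl = x∈p∪q⁺ (inj₂ x∈q)

x∉p-x : ∀ (p : Subset n) x → x ∉ p - x
x∉p-x (s ∷ p) zero    ()
x∉p-x (s ∷ p) (suc x) (there x∈p-x) = x∉p-x p x x∈p-x

x∈p-y⇒x≢y : x ∈ p - y → x ≢ y
x∈p-y⇒x≢y {p = p} {y = y} x∈p-y refl = x∉p-x p y x∈p-y

x∈p-y⇒x∈p : x ∈ p - y → x ∈ p
x∈p-y⇒x∈p {p = p} {y = y} = p─q⊆p p ⁅ y ⁆

x∈p⇒x∈p-y⊎x≡y : x ∈ p → x ∈ p - y ⊎ x ≡ y
x∈p⇒x∈p-y⊎x≡y {x = x} {y = y} x∈p with x ≟ y
... | yes x≡y = inj₂ x≡y
... | no  x≢y = inj₁ (x∈p∧x≢y⇒x∈p-y x∈p x≢y)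

x∈p∪⁅y⁆∧x≢z⇒x∈p-z∪⁅y⁆ : x ∈ p ∪ ⁅ y ⁆ → x ≢ z → x ∈ (p - z) ∪ ⁅ y ⁆
x∈p∪⁅y⁆∧x≢z⇒x∈p-z∪⁅y⁆ {p = p} x∈ x≢z with x∈p∪⁅y⁆⇒x∈p⊎x≡y {p = p} x∈
... | inj₁ x∈p  = x∈p⇒x∈p∪⁅y⁆ (x∈p∧x≢y⇒x∈p-y x∈p x≢z)
... | inj₂ refl = x∈p∪⁅x⁆ _

x∈p⇒1+∣p-x∣≡∣p∣ : ∀ (p : Subset n) x → x ∈ p → suc ∣ p - x ∣ ≡ ∣ p ∣
x∈p⇒1+∣p-x∣≡∣p∣ (inside  ∷ p) zero    here          = cong (suc ∘ ∣_∣) (p─⊥≡p p)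
x∈p⇒1+∣p-x∣≡∣p∣ (outside ∷ p) (suc x) (there x∈p) = x∈p⇒1+∣p-x∣≡∣p∣ p x x∈p
x∈p⇒1+∣p-x∣≡∣p∣ (inside  ∷ p) (suc x) (there x∈p) = cong suc (x∈p⇒1+∣p-x∣≡∣p∣ p x x∈p)

x∉p⇒∣p∪⁅x⁆∣≡1+∣p∣ : ∀ (p : Subset n) x → x ∉ p → ∣ p ∪ ⁅ x ⁆ ∣ ≡ suc ∣ p ∣
x∉p⇒∣p∪⁅x⁆∣≡1+∣p∣ (outside ∷ p) zero    x∉p = cong (suc ∘ ∣_∣) (∪-identityʳ p)
x∉p⇒∣p∪⁅x⁆∣≡1+∣p∣ (inside  ∷ p) zero    x∉p = contradiction here x∉p
x∉p⇒∣p∪⁅x⁆∣≡1+∣p∣ (outside ∷ p) (suc x) x∉p = x∉p⇒∣p∪⁅x⁆∣≡1+∣p∣ p x (x∉p ∘ there)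
x∉p⇒∣p∪⁅x⁆∣≡1+∣p∣ (inside  ∷ p) (suc x) x∉p = cong suc (x∉p⇒∣p∪⁅x⁆∣≡1+∣p∣ p x (x∉p ∘ there))

x∈p∧y∉p⇒∣p-x∪⁅y⁆∣≡∣p∣ : x ∈ p → y ∉ p → ∣ (p - x) ∪ ⁅ y ⁆ ∣ ≡ ∣ p ∣
x∈p∧y∉p⇒∣p-x∪⁅y⁆∣≡∣p∣ {x = x} {p = p} x∈p y∉p =
  trans (x∉p⇒∣p∪⁅x⁆∣≡1+∣p∣ (p - x) _ (y∉p ∘ x∈p-y⇒x∈p)) (x∈p⇒1+∣p-x∣≡∣p∣ p x x∈p)

p⊆q∧∣q∣≤∣p∣⇒q⊆p : p ⊆ q → ∣ q ∣ ≤ ∣ p ∣ → q ⊆ p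
p⊆q∧∣q∣≤∣p∣⇒q⊆p {p = p} p⊆q ∣q∣≤∣p∣ {x} x∈q with x ∈? p
... | yes x∈p = x∈p
... | no  x∉p = contradiction (≤-<-trans ∣q∣≤∣p∣ (p⊂q⇒∣p∣<∣q∣ (p⊆q , x , x∈q , x∉p))) (<-irrefl refl)

∣p∣>0⇒nonempty : 0 < ∣ p ∣ → Nonempty p
∣p∣>0⇒nonempty {n} {p} 0<∣p∣ with nonempty? p
... | yes nonempty = nonempty
... | no  empty    = contradiction (trans (cong ∣_∣ (Empty-unique empty)) (∣⊥∣≡0 n)) (>⇒≢ 0<∣p∣)

∣p∣>1∧x∈p⇒∃y∈p≢x : 1 < ∣ p ∣ → x ∈ p → ∃ λ y → y ∈ p × y ≢ x
∣p∣>1∧x∈p⇒∃y∈p≢x {p = p} {x = x} 1<∣p∣ x∈p =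
  let y , y∈p-x = ∣p∣>0⇒nonempty (≤-pred (≤-trans 1<∣p∣ (≤-reflexive (sym (x∈p⇒1+∣p-x∣≡∣p∣ p x x∈p)))))
  in y , x∈p-y⇒x∈p y∈p-x , x∈p-y⇒x≢y y∈p-x

∣p∣>1⇒∃≢ : 1 < ∣ p ∣ → ∃ λ x → ∃ λ y → x ∈ p × y ∈ p × x ≢ y
∣p∣>1⇒∃≢ 1<∣p∣ =
  let x , x∈p = ∣p∣>0⇒nonempty (≤-trans (s≤s z≤n) 1<∣p∣)
      y , y∈p , y≢x = ∣p∣>1∧x∈p⇒∃y∈p≢x 1<∣p∣ x∈p
  in x , y , x∈p , y∈p , y≢x ∘ sym

p⊆q⇒p∪⁅x⁆∪q⊆q∪⁅x⁆ : p ⊆ q → (p ∪ ⁅ x ⁆) ∪ q ⊆ q ∪ ⁅ x ⁆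
p⊆q⇒p∪⁅x⁆∪q⊆q∪⁅x⁆ {p = p} {q = q} p⊆q y∈ with x∈p∪q⁻ _ q y∈
... | inj₂ y∈q = x∈p⇒x∈p∪⁅y⁆ y∈q
... | inj₁ y∈p∪⁅x⁆ with x∈p∪⁅y⁆⇒x∈p⊎x≡y {p = p} y∈p∪⁅x⁆
...   | inj₁ y∈p  = x∈p⇒x∈p∪⁅y⁆ (p⊆q y∈p)
...   | inj₂ refl = x∈p∪⁅x⁆ _

p-x∪⁅y⁆⊆r∧x∈r⇒p∪⁅y⁆⊆r : (p - x) ∪ ⁅ y ⁆ ⊆ r → x ∈ r → p ∪ ⁅ y ⁆ ⊆ r
p-x∪⁅y⁆⊆r∧x∈r⇒p∪⁅y⁆⊆r {p = p} p-x+y⊆r x∈r z∈ with x∈p∪⁅y⁆⇒x∈p⊎x≡y {p = p} z∈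
... | inj₂ refl = p-x+y⊆r (x∈p∪⁅x⁆ _)
... | inj₁ z∈p with x∈p⇒x∈p-y⊎x≡y z∈p
...   | inj₁ z∈p-x = p-x+y⊆r (x∈p⇒x∈p∪⁅y⁆ z∈p-x)
...   | inj₂ refl  = x∈r

Disjoint-sym : Disjoint p q → Disjoint q p
Disjoint-sym {p = p} {q = q} p∩q=∅ (x , x∈q∩p) =
  let x∈q , x∈p = x∈p∩q⁻ q p x∈q∩p in p∩q=∅ (x , x∈p∩q⁺ (x∈p , x∈q))

Disjoint⇒∉ : Disjoint p q → x ∈ p → x ∉ q
Disjoint⇒∉ p∩q=∅ x∈p x∈q = p∩q=∅ (_ , x∈p∩q⁺ (x∈p , x∈q))

DisjointPair : {X Y : Set} → (X → Y → Set) → Set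
DisjointPair R = ∃ λ a₁ → ∃ λ a₂ → ∃ λ b₁ → ∃ λ b₂ → a₁ ≢ a₂ × b₁ ≢ b₂ × R a₁ b₁ × R a₂ b₂

disjoint-pair-among-three : {X Y : Set} {R : X → Y → Set} → DecidableEquality X → DecidableEquality Y →
  ∀ {a₁ a₂ a′ b₁ b₂ b′} → a₁ ≢ a₂ → b′ ≢ b₁ → R a₁ b₁ → R a₂ b₂ → R a′ b′ → DisjointPair R
disjoint-pair-among-three _≟X_ _≟Y_ {a₁} {a₂} {a′} {b₁} {b₂} {b′} a₁≢a₂ b′≢b₁ r₁ r₂ r′
  with b₁ ≟Y b₂ | a′ ≟X a₁
... | no  b₁≢b₂ | _         = a₁ , a₂ , b₁ , b₂ , a₁≢a₂ , b₁≢b₂ , r₁ , r₂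
... | yes _     | no a′≢a₁  = a′ , a₁ , b′ , b₁ , a′≢a₁ , b′≢b₁ , r′ , r₁
... | yes refl  | yes refl  = a′ , a₂ , b′ , b₂ , a₁≢a₂ , b′≢b₁ , r′ , r₂

module _ (M : Matroid n) where
  open Matroid M

  base∧x∉p⇒¬indep[p∪⁅x⁆] : IsBase M p → x ∉ p → ¬ Indep (p ∪ ⁅ x ⁆)
  base∧x∉p⇒¬indep[p∪⁅x⁆] {p = p} {x = x} (_ , maximal) x∉p =
    maximal (p ∪ ⁅ x ⁆) (p⊆p∪q ⁅ x ⁆ , x , x∈p∪⁅x⁆ x , x∉p)

  ∣indep∣≤∣base∣ : IsBase M p → Indep q → ∣ q ∣ ≤ ∣ p ∣
  ∣indep∣≤∣base∣ {p = p} {q = q} base-p indep-q with ∣ q ∣ ≤? ∣ p ∣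
  ... | yes ∣q∣≤∣p∣ = ∣q∣≤∣p∣
  ... | no  ∣q∣≰∣p∣ =
    let x , _ , x∉p , indep = indep-exchange (proj₁ base-p) indep-q (≰⇒> ∣q∣≰∣p∣)
    in contradiction indep (base∧x∉p⇒¬indep[p∪⁅x⁆] base-p x∉p)

  indep∧∣base∣≤⇒base : IsBase M p → Indep q → ∣ p ∣ ≤ ∣ q ∣ → IsBase M q
  indep∧∣base∣≤⇒base {p = p} {q = q} base-p indep-q ∣p∣≤∣q∣ = indep-q , λ r q⊂r indep-r →
    let x , _ , x∉p , indep = indep-exchange (proj₁ base-p) indep-r (≤-<-trans ∣p∣≤∣q∣ (p⊂q⇒∣p∣<∣q∣ q⊂r))
    in base∧x∉p⇒¬indep[p∪⁅x⁆] base-p x∉p indep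

  augment : Indep p → Indep q → ∃ λ r → Indep r × p ⊆ r × r ⊆ p ∪ q × ∣ q ∣ ≤ ∣ r ∣
  augment {p = p} {q = q} indep-p indep-q = augment-by ∣ q ∣ indep-p (m≤m+n ∣ q ∣ ∣ p ∣)
    where
    augment-by : ∀ k {p} → Indep p → ∣ q ∣ ≤ k + ∣ p ∣ → ∃ λ r → Indep r × p ⊆ r × r ⊆ p ∪ q × ∣ q ∣ ≤ ∣ r ∣
    augment-by k {p} indep-p ∣q∣≤k+∣p∣ with ∣ q ∣ ≤? ∣ p ∣
    ... | yes ∣q∣≤∣p∣ = p , indep-p , (λ x∈p → x∈p) , p⊆p∪q q , ∣q∣≤∣p∣
    augment-by zero    indep-p ∣q∣≤∣p∣ | no ∣q∣≰∣p∣ = contradiction ∣q∣≤∣p∣ ∣q∣≰∣p∣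
    augment-by (suc k) {p} indep-p ∣q∣≤k+1+∣p∣ | no ∣q∣≰∣p∣ =
      let x , x∈q , x∉p , indep-p+x = indep-exchange indep-p indep-q (≰⇒> ∣q∣≰∣p∣)
          ∣q∣≤k+∣p+x∣ = ≤-trans ∣q∣≤k+1+∣p∣
            (≤-reflexive (trans (sym (+-suc k ∣ p ∣)) (cong (k +_) (sym (x∉p⇒∣p∪⁅x⁆∣≡1+∣p∣ p x x∉p)))))
          r , indep-r , p+x⊆r , r⊆p+x∪q , ∣q∣≤∣r∣ = augment-by k indep-p+x ∣q∣≤k+∣p+x∣
      in r , indep-r , p+x⊆r ∘ x∈p⇒x∈p∪⁅y⁆ , x∈q⇒p∪⁅x⁆∪q⊆p∪q x∈q ∘ r⊆p+x∪q , ∣q∣≤∣r∣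

  exchange-indep⇒base : IsBase M p → x ∈ p → y ∉ p → Indep (p -ₑ x +ₑ y) → IsBase M (p -ₑ x +ₑ y)
  exchange-indep⇒base base-p x∈p y∉p indep =
    indep∧∣base∣≤⇒base base-p indep (≤-reflexive (sym (x∈p∧y∉p⇒∣p-x∪⁅y⁆∣≡∣p∣ x∈p y∉p)))

  module _ {A B : Subset n} (base-A : IsBase M A) (base-B : IsBase M B) (A∩B=∅ : Disjoint A B) where

    symmetric-exchange-of-indep : ∀ {a b} → a ∈ A → b ∈ B →
      Indep (A -ₑ a +ₑ b) → Indep (B -ₑ b +ₑ a) → SymmetricExchange M A B a b
    symmetric-exchange-of-indep a∈A b∈B indep-A-a+b indep-B-b+a =
      a∈A , b∈B ,
      exchange-indep⇒base base-A a∈A (Disjoint⇒∉ (Disjoint-sym A∩B=∅) b∈B) indep-A-a+b ,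
      exchange-indep⇒base base-B b∈B (Disjoint⇒∉ A∩B=∅ a∈A) indep-B-b+a

    module _ {a : Fin n} (a∈A : a ∈ A) where

      indep-+a-or-exchange-into-A : ∀ {T} → T ⊆ B → Indep (T +ₑ a) ⊎ ∃ λ z → z ∈ T × Indep (A -ₑ a +ₑ z)
      indep-+a-or-exchange-into-A {T} T⊆B with augment (indep-subset T⊆B (proj₁ base-B)) (proj₁ base-A)
      ... | I , indep-I , T⊆I , I⊆T∪A , ∣A∣≤∣I∣ with a ∈? I
      ...   | yes a∈I = inj₁ (indep-subset (p⊆r∧x∈r⇒p∪⁅x⁆⊆r T⊆I a∈I) indep-I)
      ...   | no  a∉I =
        let z , z∈I , z∉A-a , indep-A-a+z = indep-exchange (indep-subset (p─q⊆p A ⁅ a ⁆) (proj₁ base-A))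
                                              indep-I (<-≤-trans (x∈p⇒∣p-x∣<∣p∣ a∈A) ∣A∣≤∣I∣)
        in inj₂ (z , z∈T z∈I z∉A-a , indep-A-a+z)
        where
        z∈T : z ∈ I → z ∉ A - a → z ∈ T
        z∈T z∈I z∉A-a with x∈p∪q⁻ T A (I⊆T∪A z∈I)
        ... | inj₁ z∈T = z∈T
        ... | inj₂ z∈A = contradiction (x∈p∧x≢y⇒x∈p-y z∈A λ { refl → a∉I z∈I }) z∉A-a

      indep-+a-or-symmetric-exchange : ∀ k {T} → ∣ T ∣ ≤ k → T ⊆ B →
        Indep (T +ₑ a) ⊎ ∃ (SymmetricExchange M A B a)
      indep-+a-or-symmetric-exchange k ∣T∣≤k T⊆B with indep-+a-or-exchange-into-A T⊆B
      ... | inj₁ indep-T+a = inj₁ indep-T+a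
      indep-+a-or-symmetric-exchange zero ∣T∣≤0 T⊆B | inj₂ (z , z∈T , _) =
        contradiction (<-≤-trans (x∈p⇒∣p-x∣<∣p∣ z∈T) ∣T∣≤0) n≮0
      indep-+a-or-symmetric-exchange (suc k) {T} ∣T∣≤k+1 T⊆B | inj₂ (z , z∈T , indep-A-a+z)
        with indep-+a-or-symmetric-exchange k (≤-pred (≤-trans (x∈p⇒∣p-x∣<∣p∣ z∈T) ∣T∣≤k+1)) (T⊆B ∘ x∈p-y⇒x∈p)
      ... | inj₂ exchange = inj₂ exchange
      ... | inj₁ indep-T-z+a with augment indep-T-z+a (proj₁ base-B)
      ...   | I , indep-I , T-z+a⊆I , I⊆T-z+a∪B , ∣B∣≤∣I∣ with z ∈? I
      ...     | yes z∈I = inj₁ (indep-subset (p-x∪⁅y⁆⊆r∧x∈r⇒p∪⁅y⁆⊆r T-z+a⊆I z∈I) indep-I)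
      ...     | no  z∉I = inj₂ (z , symmetric-exchange-of-indep a∈A z∈B indep-A-a+z (indep-subset B-z+a⊆I indep-I))
        where
        z∈B : z ∈ B
        z∈B = T⊆B z∈T
        I⊆B-z+a : I ⊆ B -ₑ z +ₑ a
        I⊆B-z+a x∈I = x∈p∪⁅y⁆∧x≢z⇒x∈p-z∪⁅y⁆
          (p⊆q⇒p∪⁅x⁆∪q⊆q∪⁅x⁆ (T⊆B ∘ x∈p-y⇒x∈p) (I⊆T-z+a∪B x∈I)) λ { refl → z∉I x∈I }
        B-z+a⊆I : B -ₑ z +ₑ a ⊆ I
        B-z+a⊆I = p⊆q∧∣q∣≤∣p∣⇒q⊆p I⊆B-z+a
          (≤-trans (≤-reflexive (x∈p∧y∉p⇒∣p-x∪⁅y⁆∣≡∣p∣ z∈B (Disjoint⇒∉ A∩B=∅ a∈A))) ∣B∣≤∣I∣)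

    symmetric-exchange : ∀ {a} → a ∈ A → ∃ (SymmetricExchange M A B a)
    symmetric-exchange a∈A with indep-+a-or-symmetric-exchange a∈A ∣ B ∣ ≤-refl (λ x∈B → x∈B)
    ... | inj₂ exchange  = exchange
    ... | inj₁ indep-B+a = contradiction indep-B+a (base∧x∉p⇒¬indep[p∪⁅x⁆] base-B (Disjoint⇒∉ A∩B=∅ a∈A))

SymmetricExchange-swap : ∀ (M : Matroid n) {A B a b} → SymmetricExchange M B A b a → SymmetricExchange M A B a b
SymmetricExchange-swap M (b∈B , a∈A , base-B-b+a , base-A-a+b) = a∈A , b∈B , base-A-a+b , base-B-b+a

proposition2p5 : ∀ {n : ℕ} (M : Matroid n) → RankGreaterThan M 1 →
    (A B : Subset n) → IsBase M A → IsBase M B → Disjoint A B →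
    ∃ λ (a₁ : Fin n) → ∃ λ (a₂ : Fin n) → ∃ λ (b₁ : Fin n) → ∃ λ (b₂ : Fin n) →
      a₁ ≢ a₂ × b₁ ≢ b₂ ×
      SymmetricExchange M A B a₁ b₁ × SymmetricExchange M A B a₂ b₂
proposition2p5 M (I , indep-I , 1<∣I∣) A B base-A base-B A∩B=∅ =
  let a₁ , a₂ , a₁∈A , a₂∈A , a₁≢a₂ = ∣p∣>1⇒∃≢ (<-≤-trans 1<∣I∣ (∣indep∣≤∣base∣ M base-A indep-I))
      b₁ , exchange₁ = symmetric-exchange M base-A base-B A∩B=∅ a₁∈A
      b₂ , exchange₂ = symmetric-exchange M base-A base-B A∩B=∅ a₂∈A
      _ , b₁∈B , _ = exchange₁
      b′ , b′∈B , b′≢b₁ = ∣p∣>1∧x∈p⇒∃y∈p≢x (<-≤-trans 1<∣I∣ (∣indep∣≤∣base∣ M base-B indep-I)) b₁∈B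
      a′ , exchange′ = symmetric-exchange M base-B base-A (Disjoint-sym A∩B=∅) b′∈B
  in disjoint-pair-among-three _≟_ _≟_ a₁≢a₂ b′≢b₁ exchange₁ exchange₂ (SymmetricExchange-swap M exchange′)
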